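{- Let $G$ be an edge-colored graph on $n$ vertices which is edge-minimal, let $v\in V(G)$, $s=d^c(v)$, with the colors at $v$ indexed $1,\dots,s$ so that $d_1(v)\geq\cdots\geq d_s(v)$. Then $$rt(v)\geq \frac12\Big(\sum_{x\in N(v)}\big(d^c(x)+d^c(v)-n\big)+d(v)\sum_{1\leq j\leq s}\big(d_j(v)-1\big)-\sum_{1\leq i\leq s}d_i(v)\big(d_i(v)-1\big)-\sum_{y\in N_!(v)}d_{c(vy)}(y,N(v))\Big).$$
   Context: An edge-colored graph is a simple graph $G$ with edge coloring $c$. $d(v)$ is the degree and $d^c(u)$ the number of distinct colors on edges incident with $u$. For a color $\alpha$, a vertex $u$ and $X\subseteq V(G)$: $N_\alpha(u)=\{w\in N(u):c(uw)=\alpha\}$, $d_\alpha(u)=|N_\alpha(u)|$, $d_\alpha(u,X)=|N_\alpha(u)\cap X|$. $N_!(u)$ is the union of those sets $N_\alpha(u)$ with $|N_\alpha(u)|=1$. $G$ is edge-minimal if for every edge $e$ there is an endpoint $w$ of $e$ with $d^c_{G-e}(w)<d^c_G(w)$. $rt(v)$ is the number of rainbow triangles (triangles whose three edges have distinct colors) containing $v$. -}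

module Defs where

open import Data.Bool using (Bool; true; false; _∧_; _∨_; not)
open import Data.Nat as ℕ using (ℕ; _≡ᵇ_; _<ᵇ_)
open import Data.Fin using (Fin; toℕ)
open import Data.Fin.Properties using () renaming (_≟_ to _≟ᶠ_)
open import Data.Integer as ℤ using (ℤ; +_; 0ℤ)
open import Data.List using (List; []; _∷_; length; map; filterᵇ; allFin; foldr; deduplicateᵇ; concatMap)
open import Data.Product using (_×_; _,_)
open import Relation.Nullary.Decidable using (⌊_⌋)
open import Relation.Binary.PropositionalEquality using (_≡_)

Adj : ℕ → Set
Adj n = Fin n → Fin n → Bool

Col : ℕ → Set
Col n = Fin n → Fin n → ℕ

record ECGraph (n : ℕ) : Set where
  field
    adj     : Adj n
    col     : Col n
    adj-sym : ∀ u w → adj u w ≡ adj w u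
    adj-irr : ∀ u → adj u u ≡ false
    col-sym : ∀ u w → col u w ≡ col w u

_=ᶠ_ : ∀ {n} → Fin n → Fin n → Bool
x =ᶠ y = ⌊ x ≟ᶠ y ⌋

removeEdge : ∀ {n} → Adj n → Fin n → Fin n → Adj n
removeEdge adj u w a b =
  adj a b ∧ not (((a =ᶠ u) ∧ (b =ᶠ w)) ∨ ((a =ᶠ w) ∧ (b =ᶠ u)))

module _ {n : ℕ} (adj : Adj n) (col : Col n) where

  nbrs : Fin n → List (Fin n)
  nbrs u = filterᵇ (adj u) (allFin n)

  deg : Fin n → ℕ
  deg u = length (nbrs u)

  coloursAt : Fin n → List ℕ
  coloursAt u = deduplicateᵇ _≡ᵇ_ (map (col u) (nbrs u))

  cdeg : Fin n → ℕ
  cdeg u = length (coloursAt u)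

  nbrsα : ℕ → Fin n → List (Fin n)
  nbrsα α u = filterᵇ (λ w → col u w ≡ᵇ α) (nbrs u)

  degα : ℕ → Fin n → ℕ
  degα α u = length (nbrsα α u)

  degαN : ℕ → Fin n → Fin n → ℕ
  degαN α u v = length (filterᵇ (adj v) (nbrsα α u))

  nbrs! : Fin n → List (Fin n)
  nbrs! u = filterᵇ (λ y → degα (col u y) u ≡ᵇ 1) (nbrs u)

  rainbow : ℕ → ℕ → ℕ → Bool
  rainbow a b c = not (a ≡ᵇ b) ∧ not (b ≡ᵇ c) ∧ not (a ≡ᵇ c)

  -- rt(v): number of rainbow triangles containing v; each triangle vxy is
  -- counted once via the unordered pair {x,y} with toℕ x < toℕ y.
  rt : Fin n → ℕ
  rt v = length (filterᵇ ok (concatMap (λ x → map (x ,_) (allFin n)) (allFin n)))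
    where
    ok : Fin n × Fin n → Bool
    ok (x , y) = (toℕ x <ᵇ toℕ y) ∧ adj v x ∧ adj v y ∧ adj x y
                 ∧ rainbow (col v x) (col v y) (col x y)

EdgeMinimal : ∀ {n} → ECGraph n → Set
EdgeMinimal {n} G =
  ∀ u w → adj u w ≡ true →
    (cdeg (removeEdge adj u w) col u ℕ.< cdeg adj col u)
    Data.Sum.⊎ (cdeg (removeEdge adj u w) col w ℕ.< cdeg adj col w)
  where open ECGraph G
        import Data.Sum

sumℤ : ∀ {A : Set} → List A → (A → ℤ) → ℤ
sumℤ xs f = foldr (λ x acc → f x ℤ.+ acc) 0ℤ xs

module Submission where

-- Fix v and a neighbour x of v. Every colour at x is the colour of an edge xw where w is a
-- non-neighbour of v (v itself included, which accounts for c(xv)), or a neighbour of v with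
-- c(vw) = c(vx), or a neighbour of v with c(xw) = c(vw), or else vxw is a rainbow triangle.
-- As x lies in N_{c(vx)}(v) but not in N(x), this gives
--   d^c(x) + d(v) + 1 ≤ n + d_{c(vx)}(v) + |{y ∈ N(v) : c(xy) = c(vy)}| + |{y ∈ N(v) : vxy rainbow}|.
-- Summed over x ∈ N(v), the second term becomes Σᵢ dᵢ(v)² and the last is at most 2 rt(v).
-- The third is controlled by edge-minimality: if c(xy) = c(vy) and the colour c(vy) appears on
-- a second edge at v, then deleting vy costs neither endpoint a colour. So only y ∈ N_!(v)
-- contribute, each d_{c(vy)}(y, N(v)) times. The stated inequality is this count, rearranged.

open import Defs
open import Algebra.Properties.CommutativeSemigroup as CommutativeSemigroup using ()
open import Data.Bool using (Bool; true; false; T; not; _∧_; if_then_else_)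
open import Data.Bool.Properties using (T-≡; T-∧; ∧-zeroʳ; ∧-identityʳ; ∧-comm; ∧-assoc)
open import Data.Empty using (⊥)
open import Data.Fin using (Fin; toℕ)
open import Data.Fin.Properties using (toℕ-injective) renaming (_≟_ to _≟ᶠ_)
open import Data.List using (List; []; _∷_; length; map; filter; filterᵇ; allFin; _++_; concatMap; deduplicateᵇ)
open import Data.List.Properties using (map-++; map-∘; length-map; length-++; length-tabulate; filter-notAll)
open import Data.List.Membership.Propositional using (_∈_; _∉_)
open import Data.List.Membership.Propositional.Properties
  using (∈-filter⁺; ∈-filter⁻; ∈-map⁺; ∈-map⁻; ∈-allFin; ∈-++⁺ˡ; ∈-++⁺ʳ; ∈-deduplicate⁻)
import Data.List.Membership.Setoid.Properties as SetoidMembership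
open import Data.List.Relation.Unary.All as All using (_∷_)
open import Data.List.Relation.Unary.All.Properties using (all-filter)
open import Data.List.Relation.Unary.Any as Any using (here; there)
open import Data.List.Relation.Unary.Unique.Propositional using (Unique; []; _∷_)
open import Data.List.Relation.Unary.Unique.Propositional.Properties using (filter⁺; allFin⁺)
open import Data.Nat as ℕ using (ℕ; suc; _+_; _*_; _≤_; _<_; z≤n; s≤s; _≡ᵇ_; _<ᵇ_)
open import Data.Nat.ListAction using (sum)
open import Data.Nat.ListAction.Properties using (sum-++)
open import Data.Nat.Properties
open import Data.Product using (∃-syntax; _×_; _,_; proj₁; proj₂)
open import Data.Sum using (_⊎_; inj₁; inj₂)
open import Function using (_∘_; _∘₂_; Equivalence)
open import Relation.Binary.Definitions using (DecidableEquality; tri<; tri≈; tri>)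
open import Relation.Binary.PropositionalEquality
open import Relation.Nullary using (¬_; ¬?; yes; no; contradiction)
open import Relation.Nullary.Decidable using (T?)

open CommutativeSemigroup +-commutativeSemigroup using (interchange; xy∙z≈xz∙y)

private
  variable
    A B : Set

iverson : Bool → ℕ
iverson b = if b then 1 else 0

T-∧⁺ : ∀ {a b} → T a → T b → T (a ∧ b)
T-∧⁺ ta tb = Equivalence.from T-∧ (ta , tb)

T-∧⁻ : ∀ {a b} → T (a ∧ b) → T a × T b
T-∧⁻ = Equivalence.to T-∧

¬T⇒T-not : ∀ {b} → ¬ T b → T (not b)
¬T⇒T-not {true}  ¬t = ¬t _
¬T⇒T-not {false} _  = _

iverson-¬T : ∀ {b} → ¬ T b → iverson b ≡ 0
iverson-¬T {true}  ¬t = contradiction _ ¬t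
iverson-¬T {false} _  = refl

iverson-≤-+ : ∀ {a b c} → (T a → T b ⊎ T c) → iverson a ≤ iverson b + iverson c
iverson-≤-+ {false}                 _ = z≤n
iverson-≤-+ {true}  {true}          _ = s≤s z≤n
iverson-≤-+ {true}  {false} {true}  _ = s≤s z≤n
iverson-≤-+ {true}  {false} {false} h with h _
... | inj₁ ()
... | inj₂ ()

≡ᵇ-true⇒≡ : ∀ {a b} → (a ≡ᵇ b) ≡ true → a ≡ b
≡ᵇ-true⇒≡ {a} {b} eq = ≡ᵇ⇒≡ a b (Equivalence.from T-≡ eq)

≡ᵇ-false⇒≢ : ∀ {a b} → (a ≡ᵇ b) ≡ false → a ≢ b
≡ᵇ-false⇒≢ {a} eq refl with () ← trans (sym eq) (Equivalence.to T-≡ (≡⇒≡ᵇ a a refl))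

≢⇒T-not-≡ᵇ : ∀ {a b} → a ≢ b → T (not (a ≡ᵇ b))
≢⇒T-not-≡ᵇ {a} {b} a≢b with a ≡ᵇ b in eq
... | true  = a≢b (≡ᵇ-true⇒≡ eq)
... | false = _

T-not-≡ᵇ⇒≢ : ∀ {a b} → T (not (a ≡ᵇ b)) → a ≢ b
T-not-≡ᵇ⇒≢ {a} t refl with a ≡ᵇ a in eq
... | true  = t
... | false = ≡ᵇ-false⇒≢ {a} eq refl

-- Sums over lists

∑ : List A → (A → ℕ) → ℕ
∑ xs f = sum (map f xs)

infix 5 ∑
syntax ∑ xs (λ x → e) = ∑[ x ∈ xs ] e

∑-cong : ∀ xs {f g : A → ℕ} → (∀ {x} → x ∈ xs → f x ≡ g x) → ∑ xs f ≡ ∑ xs g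
∑-cong []       f≗g = refl
∑-cong (x ∷ xs) f≗g = cong₂ _+_ (f≗g (here refl)) (∑-cong xs (f≗g ∘ there))

∑-mono-≤ : ∀ xs {f g : A → ℕ} → (∀ {x} → x ∈ xs → f x ≤ g x) → ∑ xs f ≤ ∑ xs g
∑-mono-≤ []       f≤g = z≤n
∑-mono-≤ (x ∷ xs) f≤g = +-mono-≤ (f≤g (here refl)) (∑-mono-≤ xs (f≤g ∘ there))

∑-distrib-+ : ∀ xs (f g : A → ℕ) → ∑[ x ∈ xs ] (f x + g x) ≡ ∑ xs f + ∑ xs g
∑-distrib-+ []       f g = refl
∑-distrib-+ (x ∷ xs) f g =
  trans (cong (f x + g x +_) (∑-distrib-+ xs f g)) (interchange (f x) (g x) (∑ xs f) (∑ xs g))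

∑-const : ∀ (xs : List A) c → ∑[ _ ∈ xs ] c ≡ length xs * c
∑-const []       c = refl
∑-const (x ∷ xs) c = cong (c +_) (∑-const xs c)

∑-1≡length : ∀ (xs : List A) → ∑[ _ ∈ xs ] 1 ≡ length xs
∑-1≡length xs = trans (∑-const xs 1) (*-identityʳ (length xs))

∑-zero : ∀ (xs : List A) → ∑[ _ ∈ xs ] 0 ≡ 0
∑-zero xs = trans (∑-const xs 0) (*-zeroʳ (length xs))

∑-++ : ∀ xs ys (f : A → ℕ) → ∑ (xs ++ ys) f ≡ ∑ xs f + ∑ ys f
∑-++ xs ys f = trans (cong sum (map-++ f xs ys)) (sum-++ (map f xs) (map f ys))

∑-map : ∀ (g : A → B) xs f → ∑ (map g xs) f ≡ ∑ xs (f ∘ g)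
∑-map g xs f = cong sum (sym (map-∘ xs))

∑-concatMap : ∀ (g : A → List B) xs f → ∑ (concatMap g xs) f ≡ ∑[ x ∈ xs ] ∑ (g x) f
∑-concatMap g []       f = refl
∑-concatMap g (x ∷ xs) f =
  trans (∑-++ (g x) (concatMap g xs) f) (cong (∑ (g x) f +_) (∑-concatMap g xs f))

∑-swap : ∀ xs (ys : List B) (f : A → B → ℕ) → ∑[ x ∈ xs ] ∑ ys (f x) ≡ ∑[ y ∈ ys ] ∑[ x ∈ xs ] f x y
∑-swap []       ys f = sym (∑-zero ys)
∑-swap (x ∷ xs) ys f =
  trans (cong (∑ ys (f x) +_) (∑-swap xs ys f)) (sym (∑-distrib-+ ys (f x) _))

∑-filterᵇ : ∀ (p : A → Bool) xs f → ∑ (filterᵇ p xs) f ≡ ∑[ x ∈ xs ] (if p x then f x else 0)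
∑-filterᵇ p []       f = refl
∑-filterᵇ p (x ∷ xs) f with p x
... | true  = cong (f x +_) (∑-filterᵇ p xs f)
... | false = ∑-filterᵇ p xs f

∑-filterᵇ-iverson : ∀ (p q : A → Bool) xs →
                    ∑[ x ∈ filterᵇ p xs ] iverson (q x) ≡ ∑[ x ∈ xs ] iverson (p x ∧ q x)
∑-filterᵇ-iverson p q xs = trans (∑-filterᵇ p xs _) (∑-cong xs λ {x} _ → if-iverson (p x))
  where
  if-iverson : ∀ b {c} → (if b then iverson c else 0) ≡ iverson (b ∧ c)
  if-iverson true  = refl
  if-iverson false = refl

∑∑-filterᵇ-iverson : ∀ (p : A → Bool) (q : A → A → Bool) xs →
  ∑[ x ∈ filterᵇ p xs ] ∑[ y ∈ filterᵇ p xs ] iverson (q x y) ≡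
  ∑[ x ∈ xs ] ∑[ y ∈ xs ] iverson (p x ∧ p y ∧ q x y)
∑∑-filterᵇ-iverson p q xs = trans (∑-filterᵇ p xs _) (∑-cong xs λ {x} _ → inner x (p x))
  where
  inner : ∀ x b → (if b then ∑[ y ∈ filterᵇ p xs ] iverson (q x y) else 0) ≡
                   ∑[ y ∈ xs ] iverson (b ∧ p y ∧ q x y)
  inner x true  = ∑-filterᵇ-iverson p (q x) xs
  inner x false = sym (∑-zero xs)

length-filterᵇ : ∀ (p : A → Bool) xs → length (filterᵇ p xs) ≡ ∑[ x ∈ xs ] iverson (p x)
length-filterᵇ p []       = refl
length-filterᵇ p (x ∷ xs) with p x
... | true  = cong suc (length-filterᵇ p xs)
... | false = length-filterᵇ p xs

length-filterᵇ+length-filterᵇ-not : ∀ (p : A → Bool) xs →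
                                    length (filterᵇ p xs) + length (filterᵇ (not ∘ p) xs) ≡ length xs
length-filterᵇ+length-filterᵇ-not p []       = refl
length-filterᵇ+length-filterᵇ-not p (x ∷ xs) with p x
... | true  = cong suc (length-filterᵇ+length-filterᵇ-not p xs)
... | false = trans (+-suc _ _) (cong suc (length-filterᵇ+length-filterᵇ-not p xs))

-- Lists without duplicates

Unique-⊆⇒length≤ : DecidableEquality A → ∀ {xs ys : List A} → Unique xs →
                   (∀ {x} → x ∈ xs → x ∈ ys) → length xs ≤ length ys
Unique-⊆⇒length≤ _≟_ []                          xs⊆ys = z≤n
Unique-⊆⇒length≤ _≟_ {x ∷ xs} {ys} (x∉xs ∷ !xs) xs⊆ys = begin
  suc (length xs)     ≤⟨ s≤s (Unique-⊆⇒length≤ _≟_ !xs xs⊆others) ⟩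
  suc (length others) ≤⟨ filter-notAll ≢x? ys (Any.map (λ x≡y x≢y → x≢y x≡y) (xs⊆ys (here refl))) ⟩
  length ys           ∎
  where
  open ≤-Reasoning
  ≢x? = ¬? ∘ (x ≟_)
  others = filter ≢x? ys
  xs⊆others : ∀ {z} → z ∈ xs → z ∈ others
  xs⊆others z∈xs = ∈-filter⁺ ≢x? (xs⊆ys (there z∈xs)) (All.lookup x∉xs z∈xs)

Unique-∃≢ : DecidableEquality A → ∀ {xs : List A} {y} → Unique xs → y ∈ xs →
            length xs ≢ 1 → ∃[ z ] z ∈ xs × z ≢ y
Unique-∃≢ _≟_ {_ ∷ []}        _               _ ≢1 = contradiction refl ≢1
Unique-∃≢ _≟_ {a ∷ b ∷ _} {y} ((a≢b ∷ _) ∷ _) _ _  with a ≟ y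
... | yes a≡y = b , there (here refl) , λ b≡y → a≢b (trans a≡y (sym b≡y))
... | no  a≢y = a , here refl , a≢y

deduplicateᵇ-! : ∀ xs → Unique (deduplicateᵇ _≡ᵇ_ xs)
deduplicateᵇ-! []       = []
deduplicateᵇ-! (x ∷ xs) =
  All.map (λ x≢ᵇy x≡y → x≢ᵇy (≡⇒≡ᵇ x _ x≡y)) (all-filter _ (deduplicateᵇ _≡ᵇ_ xs))
  ∷ filter⁺ _ (deduplicateᵇ-! xs)

∈-deduplicateᵇ⁺ : ∀ {xs z} → z ∈ xs → z ∈ deduplicateᵇ _≡ᵇ_ xs
∈-deduplicateᵇ⁺ = SetoidMembership.∈-deduplicate⁺ (setoid ℕ) (T? ∘₂ _≡ᵇ_)
  (λ {_} {y} {z} z≡ᵇy x≡y → trans x≡y (sym (≡ᵇ⇒≡ z y z≡ᵇy)))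

∈-deduplicateᵇ⁻ : ∀ xs {z} → z ∈ deduplicateᵇ _≡ᵇ_ xs → z ∈ xs
∈-deduplicateᵇ⁻ = ∈-deduplicate⁻ (T? ∘₂ _≡ᵇ_)

∑-≡ᵇ-absent : ∀ {a} c ks → a ∉ ks → ∑[ i ∈ ks ] (if a ≡ᵇ i then c else 0) ≡ 0
∑-≡ᵇ-absent     c []       a∉ks = refl
∑-≡ᵇ-absent {a} c (k ∷ ks) a∉ks with a ≡ᵇ k in eq
... | true  = contradiction (here (≡ᵇ-true⇒≡ eq)) a∉ks
... | false = ∑-≡ᵇ-absent c ks (a∉ks ∘ there)

∑-≡ᵇ-unique : ∀ {a} c {ks} → Unique ks → a ∈ ks → ∑[ i ∈ ks ] (if a ≡ᵇ i then c else 0) ≡ c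
∑-≡ᵇ-unique {a} c {k ∷ ks} (k∉ks ∷ !ks) a∈ with a ≡ᵇ k in eq | a∈
... | true  | _          =
  trans (cong (c +_) (∑-≡ᵇ-absent {a} c ks λ a∈ks → All.lookup k∉ks a∈ks (sym (≡ᵇ-true⇒≡ eq)))) (+-identityʳ c)
... | false | here a≡k   = contradiction a≡k (≡ᵇ-false⇒≢ eq)
... | false | there a∈ks = ∑-≡ᵇ-unique c !ks a∈ks

∑-partition : ∀ (key : A → ℕ) g xs {ks} → Unique ks → (∀ {x} → x ∈ xs → key x ∈ ks) →
              ∑[ i ∈ ks ] ∑ (filterᵇ (λ x → key x ≡ᵇ i) xs) g ≡ ∑ xs g
∑-partition key g xs {ks} !ks key∈ks = begin
  ∑[ i ∈ ks ] ∑ (filterᵇ (λ x → key x ≡ᵇ i) xs) g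
    ≡⟨ ∑-cong ks (λ {i} _ → ∑-filterᵇ (λ x → key x ≡ᵇ i) xs g) ⟩
  ∑[ i ∈ ks ] ∑[ x ∈ xs ] (if key x ≡ᵇ i then g x else 0)
    ≡⟨ ∑-swap ks xs _ ⟩
  ∑[ x ∈ xs ] ∑[ i ∈ ks ] (if key x ≡ᵇ i then g x else 0)
    ≡⟨ ∑-cong xs (λ x∈xs → ∑-≡ᵇ-unique _ !ks (key∈ks x∈xs)) ⟩
  ∑ xs g ∎
  where open ≡-Reasoning

-- Colour degrees and edge-minimality

module _ {n : ℕ} where

  ∈-nbrs⁺ : ∀ (E : Adj n) (c : Col n) {u w} → T (E u w) → w ∈ nbrs E c u
  ∈-nbrs⁺ E c {u} {w} = ∈-filter⁺ (T? ∘ E u) (∈-allFin w)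

  ∈-nbrs⁻ : ∀ (E : Adj n) (c : Col n) {u w} → w ∈ nbrs E c u → T (E u w)
  ∈-nbrs⁻ E c {u} w∈ = proj₂ (∈-filter⁻ (T? ∘ E u) {xs = allFin n} w∈)

  colour∈coloursAt : ∀ (E : Adj n) (c : Col n) {u w} → T (E u w) → c u w ∈ coloursAt E c u
  colour∈coloursAt E c {u} u~w = ∈-deduplicateᵇ⁺ (∈-map⁺ (c u) (∈-nbrs⁺ E c u~w))

  cdeg≤length : ∀ (E : Adj n) (c : Col n) {u} {cs : List ℕ} →
                (∀ {w} → T (E u w) → c u w ∈ cs) → cdeg E c u ≤ length cs
  cdeg≤length E c {u} {cs} covers = Unique-⊆⇒length≤ ℕ._≟_ (deduplicateᵇ-! _) colour∈cs
    where
    colour∈cs : ∀ {α} → α ∈ coloursAt E c u → α ∈ cs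
    colour∈cs α∈ with w , w∈ , refl ← ∈-map⁻ (c u) (∈-deduplicateᵇ⁻ _ α∈) = covers (∈-nbrs⁻ E c w∈)

  removeEdge-keeps : ∀ (E : Adj n) {u w a b} → T (E a b) → b ≢ u → b ≢ w → T (removeEdge E u w a b)
  removeEdge-keeps E {u} {w} {a} {b} a~b b≢u b≢w with b ≟ᶠ w | b ≟ᶠ u
  ... | yes b≡w | _       = contradiction b≡w b≢w
  ... | no _    | yes b≡u = contradiction b≡u b≢u
  ... | no _    | no _
    rewrite ∧-zeroʳ (a =ᶠ u) | ∧-zeroʳ (a =ᶠ w) | ∧-identityʳ (E a b) = a~b

module _ {n : ℕ} (G : ECGraph n) where
  open ECGraph G

  adj⇒≢ : ∀ {u w} → T (adj u w) → u ≢ w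
  adj⇒≢ {u} u~u refl = subst T (adj-irr u) u~u

  ColourRepeatsAt : Fin n → Fin n → Set
  ColourRepeatsAt u w = ∃[ z ] T (adj u z) × z ≢ w × col u z ≡ col u w

  cdeg-kept : ∀ {E : Adj n} {u w} → ColourRepeatsAt u w →
              (∀ {w′} → T (adj u w′) → w′ ≢ w → T (E u w′)) → cdeg adj col u ≤ cdeg E col u
  cdeg-kept {E} {u} {w} (z , u~z , z≢w , same) kept = cdeg≤length adj col covered
    where
    covered : ∀ {w′} → T (adj u w′) → col u w′ ∈ coloursAt E col u
    covered {w′} u~w′ with w′ ≟ᶠ w
    ... | yes refl = subst (_∈ coloursAt E col u) same (colour∈coloursAt E col (kept u~z z≢w))
    ... | no  w′≢w = colour∈coloursAt E col (kept u~w′ w′≢w)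

  edgeMinimal⇒¬ColourRepeatsAtBothEnds : EdgeMinimal G → ∀ {u w} → T (adj u w) →
                                         ColourRepeatsAt u w → ColourRepeatsAt w u → ⊥
  edgeMinimal⇒¬ColourRepeatsAtBothEnds em {u} {w} u~w repeats-at-u repeats-at-w
    with em u w (Equivalence.to T-≡ u~w)
  ... | inj₁ lost-at-u = <⇒≱ lost-at-u (cdeg-kept {removeEdge adj u w} repeats-at-u λ u~w′ w′≢w →
                           removeEdge-keeps adj u~w′ (adj⇒≢ u~w′ ∘ sym) w′≢w)
  ... | inj₂ lost-at-w = <⇒≱ lost-at-w (cdeg-kept {removeEdge adj u w} repeats-at-w λ w~w′ w′≢u →
                           removeEdge-keeps adj w~w′ w′≢u (adj⇒≢ w~w′ ∘ sym))

  ∈-nbrsα⁺ : ∀ {α u w} → T (adj u w) → col u w ≡ α → w ∈ nbrsα adj col α u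
  ∈-nbrsα⁺ {α} {u} {w} u~w refl =
    ∈-filter⁺ (T? ∘ λ w → col u w ≡ᵇ α) (∈-nbrs⁺ adj col u~w) (≡⇒≡ᵇ (col u w) _ refl)

  ∈-nbrsα⁻ : ∀ {α u w} → w ∈ nbrsα adj col α u → T (adj u w) × col u w ≡ α
  ∈-nbrsα⁻ {α} {u} w∈ with w∈nbrs , same ← ∈-filter⁻ (T? ∘ λ w → col u w ≡ᵇ α) {xs = nbrs adj col u} w∈ =
    ∈-nbrs⁻ adj col w∈nbrs , ≡ᵇ⇒≡ _ _ same

  nbrsα-! : ∀ α u → Unique (nbrsα adj col α u)
  nbrsα-! α u = filter⁺ _ (filter⁺ _ (allFin⁺ n))

  degα≢1⇒ColourRepeatsAt : ∀ {u w} → T (adj u w) → degα adj col (col u w) u ≢ 1 → ColourRepeatsAt u w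
  degα≢1⇒ColourRepeatsAt u~w ≢1
    with z , z∈ , z≢w ← Unique-∃≢ _≟ᶠ_ (nbrsα-! _ _) (∈-nbrsα⁺ u~w refl) ≢1
    with u~z , same   ← ∈-nbrsα⁻ z∈ = z , u~z , z≢w , same

  rainbow⁺ : ∀ {a b c} → a ≢ b → b ≢ c → a ≢ c → T (rainbow adj col a b c)
  rainbow⁺ a≢b b≢c a≢c = T-∧⁺ (≢⇒T-not-≡ᵇ a≢b) (T-∧⁺ (≢⇒T-not-≡ᵇ b≢c) (≢⇒T-not-≡ᵇ a≢c))

  rainbow⁻ : ∀ {a b c} → T (rainbow adj col a b c) → a ≢ b × b ≢ c × a ≢ c
  rainbow⁻ {a} {b} t with a≢b , rest ← T-∧⁻ {not (a ≡ᵇ b)} t with b≢c , a≢c ← T-∧⁻ {not (b ≡ᵇ _)} rest =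
    T-not-≡ᵇ⇒≢ a≢b , T-not-≡ᵇ⇒≢ b≢c , T-not-≡ᵇ⇒≢ a≢c

  -- The neighbourhood of a vertex

  module _ (v : Fin n) where

    nonNbrs : List (Fin n)
    nonNbrs = filterᵇ (not ∘ adj v) (allFin n)

    sharedColour repeatedColour rainbowPartners colourCandidates : Fin n → List (Fin n)
    sharedColour     x = filterᵇ (adj x) (nbrsα adj col (col v x) v)
    repeatedColour   x = filterᵇ (λ y → adj x y ∧ (col x y ≡ᵇ col v y)) (nbrs adj col v)
    rainbowPartners  x =
      filterᵇ (λ y → adj x y ∧ rainbow adj col (col v x) (col v y) (col x y)) (nbrs adj col v)
    colourCandidates x = nonNbrs ++ sharedColour x ++ repeatedColour x ++ rainbowPartners x

    length-nonNbrs : length nonNbrs + deg adj col v ≡ n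
    length-nonNbrs = trans (+-comm (length nonNbrs) _)
      (trans (length-filterᵇ+length-filterᵇ-not (adj v) (allFin n)) (length-tabulate (λ x → x)))

    v∈nonNbrs : v ∈ nonNbrs
    v∈nonNbrs = ∈-filter⁺ (T? ∘ not ∘ adj v) (∈-allFin v) (subst (T ∘ not) (sym (adj-irr v)) _)

    neighbour-classification : ∀ {x w} → T (adj x w) → w ∈ colourCandidates x ⊎ col x w ≡ col x v
    neighbour-classification {x} {w} x~w with T? (adj v w)
    ... | no v≁w = inj₁ (∈-++⁺ˡ (∈-filter⁺ (T? ∘ not ∘ adj v) (∈-allFin w) (¬T⇒T-not v≁w)))
    ... | yes v~w with col v w ℕ.≟ col v x
    ...   | yes shared = inj₁ (∈-++⁺ʳ nonNbrs (∈-++⁺ˡ (∈-filter⁺ (T? ∘ adj x) (∈-nbrsα⁺ v~w shared) x~w)))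
    ...   | no vw≢vx with col x w ℕ.≟ col v w
    ...     | yes repeated = inj₁ (∈-++⁺ʳ nonNbrs (∈-++⁺ʳ (sharedColour x) (∈-++⁺ˡ
                               (∈-filter⁺ (T? ∘ _) (∈-nbrs⁺ adj col v~w) (T-∧⁺ x~w (≡⇒≡ᵇ _ _ repeated))))))
    ...     | no xw≢vw with col x w ℕ.≟ col x v
    ...       | yes xw≡xv = inj₂ xw≡xv
    ...       | no  xw≢xv = inj₁ (∈-++⁺ʳ nonNbrs (∈-++⁺ʳ (sharedColour x) (∈-++⁺ʳ (repeatedColour x)
                              (∈-filter⁺ (T? ∘ _) (∈-nbrs⁺ adj col v~w) (T-∧⁺ x~w rainbow-vxw)))))
      where
      rainbow-vxw = rainbow⁺ (vw≢vx ∘ sym) (xw≢vw ∘ sym) (λ vx≡xw → xw≢xv (trans (sym vx≡xw) (col-sym v x)))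

    length-colourCandidates : ∀ x → length (colourCandidates x) ≡
      length nonNbrs + (length (sharedColour x) + (length (repeatedColour x) + length (rainbowPartners x)))
    length-colourCandidates x = trans (length-++ nonNbrs) (cong (length nonNbrs +_)
      (trans (length-++ (sharedColour x)) (cong (length (sharedColour x) +_) (length-++ (repeatedColour x)))))

    cdeg+deg≤ : ∀ x → cdeg adj col x + deg adj col v ≤
      n + (length (sharedColour x) + (length (repeatedColour x) + length (rainbowPartners x)))
    cdeg+deg≤ x = begin
      cdeg adj col x + d                        ≤⟨ +-monoˡ-≤ d (cdeg≤length adj col covered) ⟩
      length (map (col x) candidates) + d       ≡⟨ cong (_+ d) (trans (length-map (col x) candidates)
                                                                      (length-colourCandidates x)) ⟩
      length nonNbrs + others + d               ≡⟨ xy∙z≈xz∙y (length nonNbrs) others d ⟩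
      length nonNbrs + d + others               ≡⟨ cong (_+ others) length-nonNbrs ⟩
      n + others                                ∎
      where
      open ≤-Reasoning
      d = deg adj col v
      candidates = colourCandidates x
      others = length (sharedColour x) + (length (repeatedColour x) + length (rainbowPartners x))
      covered : ∀ {w} → T (adj x w) → col x w ∈ map (col x) candidates
      covered x~w with neighbour-classification x~w
      ... | inj₁ w∈     = ∈-map⁺ (col x) w∈
      ... | inj₂ xw≡xv = subst (_∈ map (col x) candidates) (sym xw≡xv) (∈-map⁺ (col x) (∈-++⁺ˡ v∈nonNbrs))

    length-sharedColour< : ∀ {x} → T (adj v x) → length (sharedColour x) < degα adj col (col v x) v
    length-sharedColour< {x} v~x =
      filter-notAll (T? ∘ adj x) _ (Any.map (λ x≡y x~y → adj⇒≢ x~y x≡y) (∈-nbrsα⁺ v~x refl))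

    cdeg-neighbour≤ : ∀ {x} → T (adj v x) → cdeg adj col x + suc (deg adj col v) ≤
      n + (degα adj col (col v x) v + (length (repeatedColour x) + length (rainbowPartners x)))
    cdeg-neighbour≤ {x} v~x = begin
      cdeg adj col x + suc (deg adj col v)       ≡⟨ +-suc _ _ ⟩
      suc (cdeg adj col x + deg adj col v)       ≤⟨ s≤s (cdeg+deg≤ x) ⟩
      suc (n + (length (sharedColour x) + QR))   ≡⟨ +-suc n _ ⟨
      n + (suc (length (sharedColour x)) + QR)   ≤⟨ +-monoʳ-≤ n (+-monoˡ-≤ QR (length-sharedColour< v~x)) ⟩
      n + (degα adj col (col v x) v + QR)        ∎
      where
      open ≤-Reasoning
      QR = length (repeatedColour x) + length (rainbowPartners x)

    neighbour-colour∈ : ∀ {x} → x ∈ nbrs adj col v → col v x ∈ coloursAt adj col v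
    neighbour-colour∈ = colour∈coloursAt adj col ∘ ∈-nbrs⁻ adj col

    ∑-degα : ∑[ α ∈ coloursAt adj col v ] degα adj col α v ≡ deg adj col v
    ∑-degα = begin
      ∑[ α ∈ coloursAt adj col v ] length (nbrsα adj col α v)
        ≡⟨ ∑-cong (coloursAt adj col v) (λ {α} _ → sym (∑-1≡length (nbrsα adj col α v))) ⟩
      ∑[ α ∈ coloursAt adj col v ] ∑[ _ ∈ nbrsα adj col α v ] 1
        ≡⟨ ∑-partition (col v) (λ _ → 1) (nbrs adj col v) (deduplicateᵇ-! _) neighbour-colour∈ ⟩
      ∑[ _ ∈ nbrs adj col v ] 1
        ≡⟨ ∑-1≡length (nbrs adj col v) ⟩
      deg adj col v ∎
      where open ≡-Reasoning

    ∑-degα-squared : ∑[ x ∈ nbrs adj col v ] degα adj col (col v x) v ≡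
                     ∑[ α ∈ coloursAt adj col v ] degα adj col α v * degα adj col α v
    ∑-degα-squared = sym (begin
      ∑[ α ∈ coloursAt adj col v ] dα α * dα α
        ≡⟨ ∑-cong (coloursAt adj col v) (λ {α} _ → sym (∑-over-class α)) ⟩
      ∑[ α ∈ coloursAt adj col v ] ∑[ x ∈ nbrsα adj col α v ] dα (col v x)
        ≡⟨ ∑-partition (col v) (dα ∘ col v) (nbrs adj col v) (deduplicateᵇ-! _) neighbour-colour∈ ⟩
      ∑[ x ∈ nbrs adj col v ] dα (col v x) ∎)
      where
      open ≡-Reasoning
      dα : ℕ → ℕ
      dα α = degα adj col α v
      ∑-over-class : ∀ α → ∑[ x ∈ nbrsα adj col α v ] dα (col v x) ≡ dα α * dα α
      ∑-over-class α = trans (∑-cong (nbrsα adj col α v) (λ x∈ → cong dα (proj₂ (∈-nbrsα⁻ x∈))))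
                             (∑-const (nbrsα adj col α v) (dα α))

    rainbowTriangle : Fin n → Fin n → Bool
    rainbowTriangle x y = adj v x ∧ adj v y ∧ adj x y ∧ rainbow adj col (col v x) (col v y) (col x y)

    rt≡∑ : rt adj col v ≡ ∑[ x ∈ allFin n ] ∑[ y ∈ allFin n ] iverson ((toℕ x <ᵇ toℕ y) ∧ rainbowTriangle x y)
    rt≡∑ = trans (length-filterᵇ _ pairs) (trans (∑-concatMap (λ x → map (x ,_) (allFin n)) (allFin n) _)
                 (∑-cong (allFin n) λ {x} _ → ∑-map (x ,_) (allFin n) _))
      where
      pairs : List (Fin n × Fin n)
      pairs = concatMap (λ x → map (x ,_) (allFin n)) (allFin n)

    rainbowTriangle⁻ : ∀ {x y} → T (rainbowTriangle x y) →
      T (adj v x) × T (adj v y) × T (adj x y) × T (rainbow adj col (col v x) (col v y) (col x y))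
    rainbowTriangle⁻ {x} {y} t =
      let v~x , t′  = T-∧⁻ {adj v x} t
          v~y , t″ = T-∧⁻ {adj v y} t′
      in  v~x , v~y , T-∧⁻ {adj x y} t″

    rainbowTriangle-sym : ∀ {x y} → T (rainbowTriangle x y) → T (rainbowTriangle y x)
    rainbowTriangle-sym {x} {y} t
      with v~x , v~y , x~y , rb ← rainbowTriangle⁻ t
      with a≢b , b≢c , a≢c      ← rainbow⁻ {col v x} {col v y} {col x y} rb =
      T-∧⁺ v~y (T-∧⁺ v~x (T-∧⁺ (subst T (adj-sym x y) x~y)
        (rainbow⁺ (a≢b ∘ sym) (λ e → a≢c (trans e (col-sym y x))) (λ e → b≢c (trans e (col-sym y x))))))

    rainbowTriangle-ordered : ∀ {x y} → T (rainbowTriangle x y) →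
      T ((toℕ x <ᵇ toℕ y) ∧ rainbowTriangle x y) ⊎ T ((toℕ y <ᵇ toℕ x) ∧ rainbowTriangle y x)
    rainbowTriangle-ordered {x} {y} t with <-cmp (toℕ x) (toℕ y)
    ... | tri< x<y _ _ = inj₁ (T-∧⁺ (<⇒<ᵇ x<y) t)
    ... | tri> _ _ y<x = inj₂ (T-∧⁺ (<⇒<ᵇ y<x) (rainbowTriangle-sym t))
    ... | tri≈ _ x≡y _ = contradiction (toℕ-injective x≡y) (adj⇒≢ (proj₁ (proj₂ (proj₂ (rainbowTriangle⁻ t)))))

    ∑-rainbowPartners≤ : ∑[ x ∈ nbrs adj col v ] length (rainbowPartners x) ≤ 2 * rt adj col v
    ∑-rainbowPartners≤ = begin
      ∑[ x ∈ nbrs adj col v ] length (rainbowPartners x)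
        ≡⟨ ∑-cong (nbrs adj col v) (λ _ → length-filterᵇ _ (nbrs adj col v)) ⟩
      ∑[ x ∈ nbrs adj col v ] ∑[ y ∈ nbrs adj col v ]
        iverson (adj x y ∧ rainbow adj col (col v x) (col v y) (col x y))
        ≡⟨ ∑∑-filterᵇ-iverson (adj v) _ (allFin n) ⟩
      ∑[ x ∈ allFin n ] ∑[ y ∈ allFin n ] iverson (rainbowTriangle x y)
        ≤⟨ ∑-mono-≤ (allFin n) (λ _ → ∑-mono-≤ (allFin n) (λ _ → iverson-≤-+ rainbowTriangle-ordered)) ⟩
      ∑[ x ∈ allFin n ] ∑[ y ∈ allFin n ] (ordered x y + ordered y x)
        ≡⟨ ∑-cong (allFin n) (λ {x} _ → ∑-distrib-+ (allFin n) (ordered x) (λ y → ordered y x)) ⟩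
      ∑[ x ∈ allFin n ] ((∑[ y ∈ allFin n ] ordered x y) + (∑[ y ∈ allFin n ] ordered y x))
        ≡⟨ ∑-distrib-+ (allFin n) _ _ ⟩
      S + (∑[ x ∈ allFin n ] ∑[ y ∈ allFin n ] ordered y x)
        ≡⟨ cong (S +_) (trans (∑-swap (allFin n) (allFin n) (λ x y → ordered y x)) (sym (+-identityʳ S))) ⟩
      2 * S
        ≡⟨ cong (2 *_) rt≡∑ ⟨
      2 * rt adj col v ∎
      where
      open ≤-Reasoning
      ordered : Fin n → Fin n → ℕ
      ordered x y = iverson ((toℕ x <ᵇ toℕ y) ∧ rainbowTriangle x y)
      S = ∑[ x ∈ allFin n ] ∑[ y ∈ allFin n ] ordered x y

    ∑-repeatedAt≡degαN : ∀ y → ∑[ x ∈ nbrs adj col v ] iverson (adj x y ∧ (col x y ≡ᵇ col v y)) ≡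
                                degαN adj col (col v y) y v
    ∑-repeatedAt≡degαN y = begin
      ∑[ x ∈ nbrs adj col v ] iverson (adj x y ∧ (col x y ≡ᵇ col v y))
        ≡⟨ ∑-filterᵇ-iverson (adj v) _ (allFin n) ⟩
      ∑[ x ∈ allFin n ] iverson (adj v x ∧ adj x y ∧ (col x y ≡ᵇ col v y))
        ≡⟨ ∑-cong (allFin n) (λ {x} _ → cong iverson (reorder x)) ⟩
      ∑[ x ∈ allFin n ] iverson (adj y x ∧ (col y x ≡ᵇ col v y) ∧ adj v x)
        ≡⟨ ∑-filterᵇ-iverson (adj y) _ (allFin n) ⟨
      ∑[ x ∈ nbrs adj col y ] iverson ((col y x ≡ᵇ col v y) ∧ adj v x)
        ≡⟨ ∑-filterᵇ-iverson (λ x → col y x ≡ᵇ col v y) (adj v) (nbrs adj col y) ⟨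
      ∑[ x ∈ nbrsα adj col (col v y) y ] iverson (adj v x)
        ≡⟨ length-filterᵇ (adj v) (nbrsα adj col (col v y) y) ⟨
      degαN adj col (col v y) y v ∎
      where
      open ≡-Reasoning
      reorder : ∀ x → adj v x ∧ adj x y ∧ (col x y ≡ᵇ col v y) ≡ adj y x ∧ (col y x ≡ᵇ col v y) ∧ adj v x
      reorder x rewrite adj-sym x y | col-sym x y = trans (∧-comm (adj v x) _) (∧-assoc (adj y x) _ (adj v x))

    ∑-repeatedAt≡0 : EdgeMinimal G → ∀ {y} → T (adj v y) → degα adj col (col v y) v ≢ 1 →
                     ∑[ x ∈ nbrs adj col v ] iverson (adj x y ∧ (col x y ≡ᵇ col v y)) ≡ 0
    ∑-repeatedAt≡0 em {y} v~y ≢1 =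
      trans (∑-cong (nbrs adj col v) (iverson-¬T ∘ not-repeated)) (∑-zero (nbrs adj col v))
      where
      not-repeated : ∀ {x} → x ∈ nbrs adj col v → ¬ T (adj x y ∧ (col x y ≡ᵇ col v y))
      not-repeated {x} x∈ t with x~y , same ← T-∧⁻ {adj x y} t =
        edgeMinimal⇒¬ColourRepeatsAtBothEnds em v~y (degα≢1⇒ColourRepeatsAt v~y ≢1)
          (x , subst T (adj-sym x y) x~y , adj⇒≢ (∈-nbrs⁻ adj col x∈) ∘ sym
             , trans (col-sym y x) (trans (≡ᵇ⇒≡ _ _ same) (col-sym v y)))

    ∑-repeatedColour≤ : EdgeMinimal G →
      ∑[ x ∈ nbrs adj col v ] length (repeatedColour x) ≤ ∑[ y ∈ nbrs! adj col v ] degαN adj col (col v y) y v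
    ∑-repeatedColour≤ em = begin
      ∑[ x ∈ nbrs adj col v ] length (repeatedColour x)
        ≡⟨ ∑-cong (nbrs adj col v) (λ _ → length-filterᵇ _ (nbrs adj col v)) ⟩
      ∑[ x ∈ nbrs adj col v ] ∑[ y ∈ nbrs adj col v ] iverson (adj x y ∧ (col x y ≡ᵇ col v y))
        ≡⟨ ∑-swap (nbrs adj col v) (nbrs adj col v) _ ⟩
      ∑[ y ∈ nbrs adj col v ] ∑[ x ∈ nbrs adj col v ] iverson (adj x y ∧ (col x y ≡ᵇ col v y))
        ≤⟨ ∑-mono-≤ (nbrs adj col v) only-unique-colours ⟩
      ∑[ y ∈ nbrs adj col v ] (if degα adj col (col v y) v ≡ᵇ 1 then degαN adj col (col v y) y v else 0)
        ≡⟨ ∑-filterᵇ _ (nbrs adj col v) _ ⟨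
      ∑[ y ∈ nbrs! adj col v ] degαN adj col (col v y) y v ∎
      where
      open ≤-Reasoning
      only-unique-colours : ∀ {y} → y ∈ nbrs adj col v →
        ∑[ x ∈ nbrs adj col v ] iverson (adj x y ∧ (col x y ≡ᵇ col v y)) ≤
        (if degα adj col (col v y) v ≡ᵇ 1 then degαN adj col (col v y) y v else 0)
      only-unique-colours {y} y∈ with degα adj col (col v y) v ≡ᵇ 1 in unique
      ... | true  = ≤-reflexive (∑-repeatedAt≡degαN y)
      ... | false = ≤-reflexive (∑-repeatedAt≡0 em (∈-nbrs⁻ adj col y∈) (≡ᵇ-false⇒≢ unique))

    counting-bound : EdgeMinimal G →
      (∑[ x ∈ nbrs adj col v ] cdeg adj col x) + deg adj col v * suc (deg adj col v) ≤
      deg adj col v * n + (∑[ α ∈ coloursAt adj col v ] degα adj col α v * degα adj col α v)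
        + (∑[ y ∈ nbrs! adj col v ] degαN adj col (col v y) y v) + 2 * rt adj col v
    counting-bound em = begin
      (∑[ x ∈ N ] cdeg adj col x) + d * suc d
        ≡⟨ cong (∑ N (cdeg adj col) +_) (∑-const N (suc d)) ⟨
      (∑[ x ∈ N ] cdeg adj col x) + (∑[ _ ∈ N ] suc d)
        ≡⟨ ∑-distrib-+ N (cdeg adj col) _ ⟨
      ∑[ x ∈ N ] (cdeg adj col x + suc d)
        ≤⟨ ∑-mono-≤ N (cdeg-neighbour≤ ∘ ∈-nbrs⁻ adj col) ⟩
      ∑[ x ∈ N ] (n + (degα adj col (col v x) v + (length (repeatedColour x) + length (rainbowPartners x))))
        ≡⟨ trans (∑-distrib-+ N (λ _ → n) _) (cong₂ _+_ (∑-const N n)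
             (trans (∑-distrib-+ N (λ x → degα adj col (col v x) v) _)
                    (cong ((∑[ x ∈ N ] degα adj col (col v x) v) +_)
                          (∑-distrib-+ N (length ∘ repeatedColour) (length ∘ rainbowPartners))))) ⟩
      d * n + ((∑[ x ∈ N ] degα adj col (col v x) v)
               + ((∑[ x ∈ N ] length (repeatedColour x)) + (∑[ x ∈ N ] length (rainbowPartners x))))
        ≤⟨ +-monoʳ-≤ (d * n) (+-mono-≤ (≤-reflexive ∑-degα-squared)
                                       (+-mono-≤ (∑-repeatedColour≤ em) ∑-rainbowPartners≤)) ⟩
      d * n + (Σd² + (Σ! + 2 * rt adj col v))
        ≡⟨ trans (+-assoc (d * n + Σd²) Σ! _) (+-assoc (d * n) Σd² _) ⟨
      d * n + Σd² + Σ! + 2 * rt adj col v ∎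
      where
      open ≤-Reasoning
      N = nbrs adj col v
      d = deg adj col v
      Σd² = ∑[ α ∈ coloursAt adj col v ] degα adj col α v * degα adj col α v
      Σ! = ∑[ y ∈ nbrs! adj col v ] degαN adj col (col v y) y v

-- The bound over ℤ

open import Data.Integer as ℤ using (ℤ; +_; _⊖_)
open import Data.Integer.Properties as ℤ using (pos-+; pos-*; m-n≡m⊖n; ⊖-monoˡ-≤; +-cancelˡ-⊖)
open import Data.Integer.Tactic.RingSolver using (solve-∀)

sumℤ-cong : ∀ (xs : List A) {f g : A → ℤ} → (∀ x → f x ≡ g x) → sumℤ xs f ≡ sumℤ xs g
sumℤ-cong []       f≗g = refl
sumℤ-cong (x ∷ xs) f≗g = cong₂ ℤ._+_ (f≗g x) (sumℤ-cong xs f≗g)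

sumℤ-pos : ∀ (xs : List A) f → sumℤ xs (λ x → + f x) ≡ + ∑ xs f
sumℤ-pos []       f = refl
sumℤ-pos (x ∷ xs) f = trans (cong (λ s → + f x ℤ.+ s) (sumℤ-pos xs f)) (sym (pos-+ (f x) (∑ xs f)))

sumℤ-pos-diff : ∀ (xs : List A) f g → sumℤ xs (λ x → + f x ℤ.- + g x) ≡ + ∑ xs f ℤ.- + ∑ xs g
sumℤ-pos-diff []       f g = refl
sumℤ-pos-diff (x ∷ xs) f g = begin
  (+ f x ℤ.- + g x) ℤ.+ sumℤ xs (λ y → + f y ℤ.- + g y)
    ≡⟨ cong (λ s → (+ f x ℤ.- + g x) ℤ.+ s) (sumℤ-pos-diff xs f g) ⟩
  (+ f x ℤ.- + g x) ℤ.+ (+ ∑ xs f ℤ.- + ∑ xs g)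
    ≡⟨ [a-b]+[c-e]≡[a+c]-[b+e] (+ f x) (+ g x) (+ ∑ xs f) (+ ∑ xs g) ⟩
  (+ f x ℤ.+ + ∑ xs f) ℤ.- (+ g x ℤ.+ + ∑ xs g)
    ≡⟨ cong₂ ℤ._-_ (pos-+ (f x) (∑ xs f)) (pos-+ (g x) (∑ xs g)) ⟨
  + (f x + ∑ xs f) ℤ.- + (g x + ∑ xs g) ∎
  where
  open ≡-Reasoning
  [a-b]+[c-e]≡[a+c]-[b+e] : ∀ a b c e → (a ℤ.- b) ℤ.+ (c ℤ.- e) ≡ (a ℤ.+ c) ℤ.- (b ℤ.+ e)
  [a-b]+[c-e]≡[a+c]-[b+e] = solve-∀

m≤n+o⇒m-n≤o : ∀ {m} n {o} → m ≤ n + o → + m ℤ.- + n ℤ.≤ + o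
m≤n+o⇒m-n≤o {m} n {o} m≤n+o = subst₂ ℤ._≤_ (sym (m-n≡m⊖n m n)) [n+o]⊖n≡o (⊖-monoˡ-≤ n m≤n+o)
  where
  [n+o]⊖n≡o : (n + o) ⊖ n ≡ + o
  [n+o]⊖n≡o = trans (cong ((n + o) ⊖_) (sym (+-identityʳ n))) (+-cancelˡ-⊖ n o 0)

module _ {n : ℕ} (G : ECGraph n) (v : Fin n) where
  open ECGraph G

  private
    N = nbrs adj col v
    cols = coloursAt adj col v
    d = deg adj col v
    s = cdeg adj col v
    dα : ℕ → ℕ
    dα α = degα adj col α v
    Σdᶜ = ∑ N (cdeg adj col)
    Σd² = ∑[ α ∈ cols ] dα α * dα α
    Σ! = ∑[ y ∈ nbrs! adj col v ] degαN adj col (col v y) y v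

  lhs-closed-form :
    sumℤ N (λ x → + cdeg adj col x ℤ.+ + s ℤ.- + n)
      ℤ.+ + d ℤ.* sumℤ cols (λ j → + dα j ℤ.- + 1)
      ℤ.- sumℤ cols (λ i → + dα i ℤ.* (+ dα i ℤ.- + 1))
      ℤ.- sumℤ (nbrs! adj col v) (λ y → + degαN adj col (col v y) y v)
    ≡ + (Σdᶜ + d * suc d) ℤ.- + (d * n + Σd² + Σ!)
  lhs-closed-form = begin
    _ ≡⟨ cong₂ ℤ._-_ (cong₂ ℤ._-_ (cong₂ ℤ._+_ neighbourTerm (cong (+ d ℤ.*_) colourTerm)) squareTerm)
                     (sumℤ-pos (nbrs! adj col v) _) ⟩
    (+ (Σdᶜ + d * s) ℤ.- + (d * n)) ℤ.+ + d ℤ.* (+ d ℤ.- + s) ℤ.- (+ Σd² ℤ.- + d) ℤ.- + Σ!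
      ≡⟨ cong₂ (λ a b → (a ℤ.- b) ℤ.+ + d ℤ.* (+ d ℤ.- + s) ℤ.- (+ Σd² ℤ.- + d) ℤ.- + Σ!)
               (pos-+* Σdᶜ d s) (pos-* d n) ⟩
    (+ Σdᶜ ℤ.+ + d ℤ.* + s ℤ.- + d ℤ.* + n) ℤ.+ + d ℤ.* (+ d ℤ.- + s) ℤ.- (+ Σd² ℤ.- + d) ℤ.- + Σ!
      ≡⟨ rearrange (+ Σdᶜ) (+ d) (+ s) (+ n) (+ Σd²) (+ Σ!) ⟩
    (+ Σdᶜ ℤ.+ + d ℤ.* (+ 1 ℤ.+ + d)) ℤ.- (+ d ℤ.* + n ℤ.+ + Σd² ℤ.+ + Σ!)
      ≡⟨ cong₂ ℤ._-_ (trans (pos-+* Σdᶜ d (suc d)) (cong (λ t → + Σdᶜ ℤ.+ + d ℤ.* t) (pos-+ 1 d)))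
                     (trans (pos-+ (d * n + Σd²) Σ!)
                            (cong (ℤ._+ + Σ!) (trans (pos-+ (d * n) Σd²) (cong (ℤ._+ + Σd²) (pos-* d n))))) ⟨
    + (Σdᶜ + d * suc d) ℤ.- + (d * n + Σd² + Σ!) ∎
    where
    open ≡-Reasoning
    pos-+* : ∀ a b c → + (a + b * c) ≡ + a ℤ.+ + b ℤ.* + c
    pos-+* a b c = trans (pos-+ a (b * c)) (cong (λ t → + a ℤ.+ t) (pos-* b c))
    rearrange : ∀ C D S K Q M → (C ℤ.+ D ℤ.* S ℤ.- D ℤ.* K) ℤ.+ D ℤ.* (D ℤ.- S) ℤ.- (Q ℤ.- D) ℤ.- M
                                ≡ (C ℤ.+ D ℤ.* (+ 1 ℤ.+ D)) ℤ.- (D ℤ.* K ℤ.+ Q ℤ.+ M)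
    rearrange = solve-∀
    neighbourTerm : sumℤ N (λ x → + cdeg adj col x ℤ.+ + s ℤ.- + n) ≡ + (Σdᶜ + d * s) ℤ.- + (d * n)
    neighbourTerm = begin
      sumℤ N (λ x → + cdeg adj col x ℤ.+ + s ℤ.- + n)
        ≡⟨ sumℤ-cong N (λ x → cong (ℤ._- + n) (pos-+ (cdeg adj col x) s)) ⟨
      sumℤ N (λ x → + (cdeg adj col x + s) ℤ.- + n)
        ≡⟨ sumℤ-pos-diff N (λ x → cdeg adj col x + s) (λ _ → n) ⟩
      + (∑[ x ∈ N ] (cdeg adj col x + s)) ℤ.- + (∑[ _ ∈ N ] n)
        ≡⟨ cong₂ (λ a b → + a ℤ.- + b)
                 (trans (∑-distrib-+ N (cdeg adj col) _) (cong (λ t → Σdᶜ + t) (∑-const N s))) (∑-const N n) ⟩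
      + (Σdᶜ + d * s) ℤ.- + (d * n) ∎
    colourTerm : sumℤ cols (λ j → + dα j ℤ.- + 1) ≡ + d ℤ.- + s
    colourTerm = trans (sumℤ-pos-diff cols dα (λ _ → 1))
                       (cong₂ (λ a b → + a ℤ.- + b) (∑-degα G v) (∑-1≡length cols))
    squareTerm : sumℤ cols (λ i → + dα i ℤ.* (+ dα i ℤ.- + 1)) ≡ + Σd² ℤ.- + d
    squareTerm = trans (sumℤ-cong cols summand)
                       (trans (sumℤ-pos-diff cols (λ i → dα i * dα i) dα) (cong (λ t → + Σd² ℤ.- + t) (∑-degα G v)))
      where
      a[a-1]≡aa-a : ∀ a → a ℤ.* (a ℤ.- + 1) ≡ a ℤ.* a ℤ.- a
      a[a-1]≡aa-a = solve-∀
      summand : ∀ i → + dα i ℤ.* (+ dα i ℤ.- + 1) ≡ + (dα i * dα i) ℤ.- + dα i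
      summand i = trans (a[a-1]≡aa-a (+ dα i)) (cong (ℤ._- + dα i) (sym (pos-* (dα i) (dα i))))

  closed-form≤2rt : EdgeMinimal G → + (Σdᶜ + d * suc d) ℤ.- + (d * n + Σd² + Σ!) ℤ.≤ + (2 * rt adj col v)
  closed-form≤2rt em = m≤n+o⇒m-n≤o (d * n + Σd² + Σ!) (counting-bound G v em)

corollary1 : ∀ {n} (G : ECGraph n) → EdgeMinimal G → (v : Fin n) →
    let open ECGraph G in
    (sumℤ (nbrs adj col v) (λ x → + cdeg adj col x ℤ.+ + cdeg adj col v ℤ.- + n)
      ℤ.+ (+ deg adj col v) ℤ.* sumℤ (coloursAt adj col v) (λ j → + degα adj col j v ℤ.- + 1)
      ℤ.- sumℤ (coloursAt adj col v) (λ i → + degα adj col i v ℤ.* (+ degα adj col i v ℤ.- + 1))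
      ℤ.- sumℤ (nbrs! adj col v) (λ y → + degαN adj col (col v y) y v))
    ℤ.≤ + (2 ℕ.* rt adj col v)
corollary1 G em v = ℤ.≤-trans (ℤ.≤-reflexive (lhs-closed-form G v)) (closed-form≤2rt G v em)
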